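{- Let $m>1$ be an integer and let $(a,b,c)$ be an ordered improper $m$-Markoff triple. Then $a=b$ and $(a,a,c)$ is minimal.
   Context: An $m$-Markoff triple is a triple $(a,b,c)$ of positive integers with $a^2+b^2+c^2=3abc+m$. It is ordered if $a\le b\le c$, and improper if $a,b,c$ are not pairwise distinct. A minimal triple is an $m$-Markoff triple $(a,b,c)$ with $a\le b\le c$ and $3ab-c\le 0$. -}

module Defs where

open import Data.Nat using (ℕ; _+_; _*_; _≤_; _<_)
open import Data.Product using (_×_)
open import Data.Sum using (_⊎_)
open import Relation.Binary.PropositionalEquality using (_≡_)

-- (a,b,c) is an m-Markoff triple: positive integers with a²+b²+c² = 3abc + m.
-- Since all quantities are natural numbers and m > 1 in our use, working in ℕ is faithful.
IsMarkoff : ℕ → ℕ → ℕ → ℕ → Set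
IsMarkoff m a b c =
  (0 < a × 0 < b × 0 < c) ×
  (a * a + b * b + c * c ≡ 3 * a * b * c + m)

Ordered : ℕ → ℕ → ℕ → Set
Ordered a b c = a ≤ b × b ≤ c

Improper : ℕ → ℕ → ℕ → Set
Improper a b c = a ≡ b ⊎ b ≡ c ⊎ a ≡ c

-- minimal: m-Markoff, ordered, and 3ab - c ≤ 0 (as integers), i.e. 3ab ≤ c
Minimal : ℕ → ℕ → ℕ → ℕ → Set
Minimal m a b c = IsMarkoff m a b c × Ordered a b c × 3 * a * b ≤ c

{-# OPTIONS --safe #-}
module Submission where

open import Defs
open import Data.Nat using (ℕ; suc; _+_; _*_; _≤_; _<_; s≤s; z≤n)
open import Data.Nat.Properties
open import Data.Nat.Tactic.RingSolver using (solve)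
open import Data.List using ([]; _∷_)
open import Data.Product using (_×_; _,_)
open import Data.Sum using (inj₁; inj₂)
open import Data.Empty using (⊥-elim)
open import Relation.Nullary using (¬_)
open import Relation.Binary.PropositionalEquality using (_≡_; refl; sym; cong)

-- If b = c then a² + 2b² ≤ 3b² ≤ 3ab² leaves no room for m. If a = b and
-- c < 3a², then x = 3a² satisfies 3xc − 3c² − 2x = −3m ≤ −3; but the left side is increasing in x
-- for c ≥ 1, and already at x = c + 1 it equals c − 2 ≥ −1.

a*a+b*b+b*b≤3*a*b*b : ∀ {a b} → 0 < a → a ≤ b → a * a + b * b + b * b ≤ 3 * a * b * b
a*a+b*b+b*b≤3*a*b*b {a} {b} 0<a a≤b = begin
  a * a + b * b + b * b ≤⟨ +-monoˡ-≤ (b * b) (+-monoˡ-≤ (b * b) (*-mono-≤ a≤b a≤b)) ⟩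
  b * b + b * b + b * b ≡⟨ solve (b ∷ []) ⟩
  3 * 1 * b * b         ≤⟨ *-monoˡ-≤ b (*-monoˡ-≤ b (*-monoʳ-≤ 3 0<a)) ⟩
  3 * a * b * b         ∎
  where open ≤-Reasoning

¬IsMarkoff-b≡c : ∀ {m a b} → 0 < m → a ≤ b → ¬ IsMarkoff m a b b
¬IsMarkoff-b≡c {m} {a} {b} 0<m a≤b ((0<a , _ , _) , eq) = <-irrefl refl (begin-strict
  3 * a * b * b         <⟨ m<m+n _ 0<m ⟩
  3 * a * b * b + m     ≡⟨ sym eq ⟩
  a * a + b * b + b * b ≤⟨ a*a+b*b+b*b≤3*a*b*b 0<a a≤b ⟩
  3 * a * b * b         ∎)
  where open ≤-Reasoning

2*x+3*c*c<3*x*c+3 : ∀ {x c} → 0 < c → c < x → 2 * x + 3 * (c * c) < 3 * x * c + 3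
2*x+3*c*c<3*x*c+3 {x} {c@(suc c′)} _ c<x with m≤n⇒∃[o]m+o≡n c<x
... | e , refl = begin-strict
  2 * (suc c + e) + 3 * (c * c)                                 <⟨ m<m+n _ (s≤s z≤n) ⟩
  2 * (suc c + e) + 3 * (c * c) + suc (c′ + 3 * e * c′ + e + 1) ≡⟨ solve (c′ ∷ e ∷ []) ⟩
  3 * (suc c + e) * c + 3                                       ∎
  where open ≤-Reasoning

IsMarkoff-a≡b⇒3*a*a≤c : ∀ {m a c} → 0 < m → IsMarkoff m a a c → 3 * a * a ≤ c
IsMarkoff-a≡b⇒3*a*a≤c {m} {a} {c} 0<m ((_ , _ , 0<c) , eq) = ≮⇒≥ λ c<3aa → <-irrefl refl (begin-strict
  2 * (3 * a * a) + 3 * (c * c) <⟨ 2*x+3*c*c<3*x*c+3 0<c c<3aa ⟩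
  3 * (3 * a * a) * c + 3       ≤⟨ +-monoʳ-≤ (3 * (3 * a * a) * c) (*-monoʳ-≤ 3 0<m) ⟩
  3 * (3 * a * a) * c + 3 * m   ≡⟨ solve (a ∷ c ∷ m ∷ []) ⟩
  3 * (3 * a * a * c + m)       ≡⟨ cong (3 *_) (sym eq) ⟩
  3 * (a * a + a * a + c * c)   ≡⟨ solve (a ∷ c ∷ []) ⟩
  2 * (3 * a * a) + 3 * (c * c) ∎)
  where open ≤-Reasoning

IsMarkoff-ordered-improper⇒a≡b : ∀ {m a b c} → 0 < m → IsMarkoff m a b c → Ordered a b c →
                                  Improper a b c → a ≡ b
IsMarkoff-ordered-improper⇒a≡b _   _  _           (inj₁ a≡b)        = a≡b
IsMarkoff-ordered-improper⇒a≡b 0<m mk (a≤b , _)   (inj₂ (inj₁ refl)) = ⊥-elim (¬IsMarkoff-b≡c 0<m a≤b mk)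
IsMarkoff-ordered-improper⇒a≡b _   _  (a≤b , b≤c) (inj₂ (inj₂ refl)) = ≤-antisym a≤b b≤c

proposition2p1 : (m a b c : ℕ) → 1 < m → IsMarkoff m a b c → Ordered a b c →
                 Improper a b c → a ≡ b × Minimal m a a c
proposition2p1 m a b c 1<m mk ord@(_ , b≤c) imp
  with refl ← IsMarkoff-ordered-improper⇒a≡b (<⇒≤ 1<m) mk ord imp
  = refl , mk , (≤-refl , b≤c) , IsMarkoff-a≡b⇒3*a*a≤c (<⇒≤ 1<m) mk
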